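{- Let $\Gamma$ be a finite Abelian group and $G$ a graph all of whose vertices are neutral. Suppose $\ell$ is a $\Gamma$-vertex magic labeling of $G$ with magic constant $g$, and $G$ contains an edge $uv$ with $\ell(u)=\ell(v)\neq g$. Let $n\equiv 0\pmod 4$ be a positive integer and let $G^\dagger$ be the graph obtained from $G$ by subdividing the edge $uv$ $n$ times (i.e., replacing $uv$ by a path $u,u_1,\dots,u_n,v$ with $n$ new internal vertices). Then $G^\dagger$ is $\Gamma$-vertex magic.
   Context: Graphs are finite, simple and undirected. For an additive Abelian group $\Gamma$ with identity $0$ and a graph $G$, a $\Gamma$-vertex magic labeling is a map $\ell:V(G)\to\Gamma\setminus\{0\}$ for which there is $\mu\in\Gamma$ (the magic constant) with $w(v)=\sum_{y\in N(v)}\ell(y)=\mu$ for every vertex $v$. A pendant vertex has degree $1$; a support vertex is one adjacent to a pendant vertex; a neutral vertex is neither pendant nor support. -}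

module Defs where

open import Level using (Level)
open import Data.Nat as ℕ using (ℕ; zero; suc; _≡ᵇ_; ∣_-_∣)
open import Data.Nat.Properties using (∣-∣-comm; ∣n-n∣≡0)
open import Data.Bool using (Bool; true; false; _∧_; _∨_; not)
open import Data.Bool.Properties using (∨-comm; ∧-comm)
open import Data.Fin as Fin using (Fin; toℕ; splitAt)
open import Data.Sum using (_⊎_; inj₁; inj₂)
open import Data.Product using (Σ; ∃-syntax; _×_; _,_)
open import Relation.Nullary using (¬_)
open import Relation.Nullary.Decidable using (⌊_⌋)
open import Relation.Binary.PropositionalEquality using (_≡_; _≢_; refl; cong; cong₂)
open import Algebra.Bundles using (AbelianGroup)

record Graph (m : ℕ) : Set where
  field
    adj    : Fin m → Fin m → Bool
    sym    : ∀ x y → adj x y ≡ adj y x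
    irrefl : ∀ x → adj x x ≡ false
open Graph public

count : ∀ {m} → (Fin m → Bool) → ℕ
count {zero}  p = 0
count {suc m} p = (if p Fin.zero then 1 else 0) ℕ.+ count (λ i → p (Fin.suc i))
  where open import Data.Bool using (if_then_else_)

degree : ∀ {m} → Graph m → Fin m → ℕ
degree G v = count (adj G v)

Pendant : ∀ {m} → Graph m → Fin m → Set
Pendant G v = degree G v ≡ 1

Support : ∀ {m} → Graph m → Fin m → Set
Support G v = ∃[ w ] (adj G v w ≡ true × Pendant G w)

Neutral : ∀ {m} → Graph m → Fin m → Set
Neutral G v = ¬ Pendant G v × ¬ Support G v

AllNeutral : ∀ {m} → Graph m → Set
AllNeutral G = ∀ v → Neutral G v

module _ {c ℓ : Level} (Γ : AbelianGroup c ℓ) where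
  open AbelianGroup Γ

  IsFiniteGroup : Set (c Level.⊔ ℓ)
  IsFiniteGroup = ∃[ k ] Σ (Fin k → Carrier) (λ f → ∀ x → ∃[ i ] (f i ≈ x))

  sumWhere : ∀ {m} → (Fin m → Bool) → (Fin m → Carrier) → Carrier
  sumWhere {zero}  p f = ε
  sumWhere {suc m} p f =
    (if p Fin.zero then f Fin.zero else ε) ∙ sumWhere (λ i → p (Fin.suc i)) (λ i → f (Fin.suc i))
    where open import Data.Bool using (if_then_else_)

  weight : ∀ {m} → Graph m → (Fin m → Carrier) → Fin m → Carrier
  weight G lab v = sumWhere (adj G v) lab

  IsVertexMagicLabeling : ∀ {m} → Graph m → (Fin m → Carrier) → Carrier → Set ℓ
  IsVertexMagicLabeling G lab μ = (∀ v → ¬ (lab v ≈ ε)) × (∀ v → weight G lab v ≈ μ)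

  IsVertexMagic : ∀ {m} → Graph m → Set (c Level.⊔ ℓ)
  IsVertexMagic G = ∃[ lab ] ∃[ μ ] IsVertexMagicLabeling G lab μ

-- Vertex set Fin (m + n):
-- the first m are the old vertices (splitAt m gives inj₁), the last n
-- are the new path vertices u₁,…,uₙ (inj₂ j is u_{j+1}).  The edge uv is
-- removed and replaced by the path u, u₁, …, uₙ, v.

module Subdivision {m : ℕ} (G : Graph m) (u v : Fin m) (n : ℕ) where

  _==_ : Fin m → Fin m → Bool
  a == b = ⌊ a Fin.≟ b ⌋

  isUV : Fin m → Fin m → Bool
  isUV a b = (a == u ∧ b == v) ∨ (a == v ∧ b == u)

  isUV-sym : ∀ a b → isUV a b ≡ isUV b a
  isUV-sym a b
    rewrite ∧-comm (a == u) (b == v) | ∧-comm (a == v) (b == u)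
    = ∨-comm (b == v ∧ a == u) (b == u ∧ a == v)

  endAdj : Fin m → Fin n → Bool
  endAdj a j = (a == u ∧ (toℕ j ≡ᵇ 0)) ∨ (a == v ∧ (suc (toℕ j) ≡ᵇ n))

  adj† : Fin (m ℕ.+ n) → Fin (m ℕ.+ n) → Bool
  adj† x y with splitAt m x | splitAt m y
  ... | inj₁ a | inj₁ b = adj G a b ∧ not (isUV a b)
  ... | inj₁ a | inj₂ j = endAdj a j
  ... | inj₂ i | inj₁ b = endAdj b i
  ... | inj₂ i | inj₂ j = ∣ toℕ i - toℕ j ∣ ≡ᵇ 1

  adj†-sym : ∀ x y → adj† x y ≡ adj† y x
  adj†-sym x y with splitAt m x | splitAt m y
  ... | inj₁ a | inj₁ b = cong₂ (λ p q → p ∧ not q) (sym G a b) (isUV-sym a b)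
  ... | inj₁ a | inj₂ j = refl
  ... | inj₂ i | inj₁ b = refl
  ... | inj₂ i | inj₂ j = cong (_≡ᵇ 1) (∣-∣-comm (toℕ i) (toℕ j))

  adj†-irrefl : ∀ x → adj† x x ≡ false
  adj†-irrefl x with splitAt m x
  ... | inj₁ a rewrite irrefl G a = refl
  ... | inj₂ i rewrite ∣n-n∣≡0 (toℕ i) = refl

  subdivided : Graph (m ℕ.+ n)
  subdivided = record { adj = adj† ; sym = adj†-sym ; irrefl = adj†-irrefl }

subdivide : ∀ {m} → Graph m → Fin m → Fin m → (n : ℕ) → Graph (m ℕ.+ n)
subdivide G u v n = Subdivision.subdivided G u v n

{-# OPTIONS --safe #-}
-- Keep ℓ on the old vertices and label the new path u = x₀, x₁, …, xₙ, xₙ₊₁ = v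
-- periodically by a, a, b, b, a, a, b, b, … where a = ℓ(u) and b = g - a, which is
-- nonzero because ℓ(u) ≠ g.  The two path neighbours of an internal vertex sit two
-- steps apart in the pattern, so their labels sum to a + b = g.  Since 4 ∣ n, both
-- x₁ and xₙ carry a = ℓ(u) = ℓ(v): u and v each replace the lost neighbour by one
-- with the same label, so their weights, like those of all other old vertices, stay g.
module Submission where

open import Defs hiding (sym)
open import Level using (Level)
open import Data.Nat using (ℕ; zero; suc; _+_; _*_; _≤_; _<_; _≡ᵇ_; _<ᵇ_; ∣_-_∣; s≤s)
open import Data.Nat.Properties using (+-comm; <⇒≤; ≤-pred; n<1+n; ≤-reflexive; <-asym; <⇒<ᵇ; ≡ᵇ⇒≡)
open import Data.Bool using (Bool; true; false; T; _∧_; _∨_; not; if_then_else_)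
open import Data.Bool.Properties using (∧-comm; T-≡; T-∧; T-∨)
open import Data.Fin as Fin using (Fin; toℕ; _↑ˡ_; _↑ʳ_; splitAt)
open import Data.Fin.Properties using (punchInᵢ≢i; splitAt-↑ˡ; splitAt-↑ʳ; join-splitAt; toℕ<n)
open import Data.Product using (_×_; _,_; proj₁)
open import Data.Sum using (inj₁; inj₂; [_,_]; [_,_]′)
open import Data.Empty using (⊥-elim)
open import Function using (_∘_; Equivalence)
open import Relation.Nullary using (¬_; yes; no)
open import Relation.Nullary.Decidable using (⌊_⌋; toWitness)
open import Relation.Binary.PropositionalEquality as ≡ using (_≡_; _≢_)
open import Algebra.Bundles using (AbelianGroup)
open import Data.Nat.Divisibility using (_∣_; divides)

module FiniteSums {c ℓ : Level} (Γ : AbelianGroup c ℓ) where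
  open AbelianGroup Γ
  open import Algebra.Properties.CommutativeMonoid.Sum commutativeMonoid public
  open import Relation.Binary.Reasoning.Setoid setoid

  when : Bool → Carrier → Carrier
  when b x = if b then x else ε

  when-cong : ∀ b {x y} → x ≈ y → when b x ≈ when b y
  when-cong true  x≈y = x≈y
  when-cong false _   = refl

  when-∧ : ∀ b c x → when (b ∧ c) x ≡ when b (when c x)
  when-∧ true  c x = ≡.refl
  when-∧ false c x = ≡.refl

  when-∨ : ∀ b c x → ¬ (T b × T c) → when (b ∨ c) x ≈ when b x ∙ when c x
  when-∨ true  true  x excl = ⊥-elim (excl (_ , _))
  when-∨ true  false x _    = sym (identityʳ x)
  when-∨ false true  x _    = sym (identityˡ x)
  when-∨ false false x _    = sym (identityˡ ε)

  when-∧-not : ∀ b c x → (T c → T b) → when b x ≈ when (b ∧ not c) x ∙ when c x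
  when-∧-not true  true  x _   = sym (identityˡ x)
  when-∧-not true  false x _   = sym (identityʳ x)
  when-∧-not false false x _   = sym (identityˡ ε)
  when-∧-not false true  x c⇒b = ⊥-elim (c⇒b _)

  sumWhere≡∑-when : ∀ {m} (p : Fin m → Bool) (f : Fin m → Carrier) →
                    sumWhere Γ p f ≡ ∑[ i < m ] when (p i) (f i)
  sumWhere≡∑-when {zero}  p f = ≡.refl
  sumWhere≡∑-when {suc m} p f =
    ≡.cong (when (p Fin.zero) (f Fin.zero) ∙_) (sumWhere≡∑-when (p ∘ Fin.suc) (f ∘ Fin.suc))

  sum-zero : ∀ {m} (f : Fin m → Carrier) → (∀ i → f i ≈ ε) → sum f ≈ ε
  sum-zero {m} f f≈ε = trans (sum-cong-≋ f≈ε) (sum-replicate-zero m)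

  sum-δ : ∀ {m} (f : Fin m → Carrier) (k : Fin m) → (∀ i → i ≢ k → f i ≈ ε) → sum f ≈ f k
  sum-δ {suc m} f k f≈ε = begin
    sum f                           ≈⟨ sum-remove f ⟩
    f k ∙ sum (removeAt f k)        ≈⟨ ∙-congˡ (sum-zero _ (λ i → f≈ε _ (punchInᵢ≢i k i))) ⟩
    f k ∙ ε                         ≈⟨ identityʳ (f k) ⟩
    f k                             ∎
    where open import Data.Vec.Functional using (removeAt)

  sum-↑ : ∀ m {n} (f : Fin (m + n) → Carrier) →
          sum f ≈ ∑[ i < m ] f (i ↑ˡ n) ∙ ∑[ j < n ] f (m ↑ʳ j)
  sum-↑ zero    f = sym (identityˡ (sum f))
  sum-↑ (suc m) f = trans (∙-congˡ (sum-↑ m (f ∘ Fin.suc))) (sym (assoc _ _ _))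

  sum-when : ∀ {m} b (f : Fin m → Carrier) → ∑[ i < m ] when b (f i) ≈ when b (sum f)
  sum-when {m} true  f = refl
  sum-when {m} false f = sum-zero {m} _ (λ _ → refl)

  sum-when-∧ : ∀ {m} b (p : Fin m → Bool) (f : Fin m → Carrier) →
               ∑[ i < m ] when (b ∧ p i) (f i) ≈ when b (∑[ i < m ] when (p i) (f i))
  sum-when-∧ b p f = trans (reflexive (sum-cong-≗ (λ i → when-∧ b (p i) (f i))))
                           (sum-when b (λ i → when (p i) (f i)))

  sum-when-∨ : ∀ {m} (p q : Fin m → Bool) (f : Fin m → Carrier) → (∀ i → ¬ (T (p i) × T (q i))) →
               ∑[ i < m ] when (p i ∨ q i) (f i) ≈ ∑[ i < m ] when (p i) (f i) ∙ ∑[ i < m ] when (q i) (f i)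
  sum-when-∨ p q f excl = trans (sum-cong-≋ (λ i → when-∨ (p i) (q i) (f i) (excl i)))
                                (∑-distrib-+ (λ i → when (p i) (f i)) (λ i → when (q i) (f i)))

  sum-when-≟ : ∀ {m} (k : Fin m) (f : Fin m → Carrier) → ∑[ i < m ] when ⌊ i Fin.≟ k ⌋ (f i) ≈ f k
  sum-when-≟ k f = trans (sum-δ _ k off-k) on-k
    where
    off-k : ∀ i → i ≢ k → when ⌊ i Fin.≟ k ⌋ (f i) ≈ ε
    off-k i i≢k with i Fin.≟ k
    ... | yes i≡k = ⊥-elim (i≢k i≡k)
    ... | no _    = refl
    on-k : when ⌊ k Fin.≟ k ⌋ (f k) ≈ f k
    on-k with k Fin.≟ k
    ... | yes _   = refl
    ... | no k≢k  = ⊥-elim (k≢k ≡.refl)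

  sum-when-∧-≟ : ∀ {m} b (k : Fin m) (f : Fin m → Carrier) →
                 ∑[ i < m ] when (b ∧ ⌊ i Fin.≟ k ⌋) (f i) ≈ when b (f k)
  sum-when-∧-≟ b k f = trans (sum-when-∧ b _ f) (when-cong b (sum-when-≟ k f))

  sum-when-≟-∧ : ∀ {m} (k : Fin m) b (f : Fin m → Carrier) →
                 ∑[ i < m ] when (⌊ i Fin.≟ k ⌋ ∧ b) (f i) ≈ when b (f k)
  sum-when-≟-∧ k b f =
    trans (reflexive (sum-cong-≗ (λ i → ≡.cong (λ d → when d (f i)) (∧-comm _ b)))) (sum-when-∧-≟ b k f)

  sum-when-toℕ≡ᵇ : ∀ {n} k (F : ℕ → Carrier) →
                   ∑[ i < n ] when (toℕ i ≡ᵇ k) (F (toℕ i)) ≈ when (k <ᵇ n) (F k)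
  sum-when-toℕ≡ᵇ {zero}  k       F = refl
  sum-when-toℕ≡ᵇ {suc n} zero    F = trans (∙-congˡ (sum-zero {n} _ (λ _ → refl))) (identityʳ (F 0))
  sum-when-toℕ≡ᵇ {suc n} (suc k) F = trans (identityˡ _) (sum-when-toℕ≡ᵇ {n} k (F ∘ suc))

  sum-when-∧-toℕ≡ᵇ : ∀ {n} b k (F : ℕ → Carrier) →
                     ∑[ i < n ] when (b ∧ (toℕ i ≡ᵇ k)) (F (toℕ i)) ≈ when b (when (k <ᵇ n) (F k))
  sum-when-∧-toℕ≡ᵇ {n} b k F = trans (sum-when-∧ {n} b (λ i → toℕ i ≡ᵇ k) (F ∘ toℕ))
                                     (when-cong b (sum-when-toℕ≡ᵇ {n} k F))

  when-<ᵇ : ∀ {k n} x → k < n → when (k <ᵇ n) x ≡ x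
  when-<ᵇ x k<n rewrite Equivalence.to T-≡ (<⇒<ᵇ k<n) = ≡.refl

  when-≡ᵇ0∙sum-when-suc≡ᵇ : ∀ {n} t → t ≤ n → (F : ℕ → Carrier) →
    when (t ≡ᵇ 0) (F 0) ∙ ∑[ i < n ] when (suc (toℕ i) ≡ᵇ t) (F (suc (toℕ i))) ≈ F t
  when-≡ᵇ0∙sum-when-suc≡ᵇ {n} zero    _   F =
    trans (∙-congˡ (sum-zero {n} _ (λ _ → refl))) (identityʳ (F 0))
  when-≡ᵇ0∙sum-when-suc≡ᵇ {n} (suc t) t<n F = begin
    ε ∙ ∑[ i < n ] when (toℕ i ≡ᵇ t) (F (suc (toℕ i)))  ≈⟨ identityˡ _ ⟩
    ∑[ i < n ] when (toℕ i ≡ᵇ t) (F (suc (toℕ i)))      ≈⟨ sum-when-toℕ≡ᵇ {n} t (F ∘ suc) ⟩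
    when (t <ᵇ n) (F (suc t))                            ≡⟨ when-<ᵇ (F (suc t)) t<n ⟩
    F (suc t)                                            ∎

  when-≡ᵇ∙when-<ᵇ : ∀ {k n} → k ≤ n → (F : ℕ → Carrier) →
                    when (k ≡ᵇ n) (F n) ∙ when (k <ᵇ n) (F k) ≈ F k
  when-≡ᵇ∙when-<ᵇ {zero}  {zero}  _         F = identityʳ (F 0)
  when-≡ᵇ∙when-<ᵇ {zero}  {suc n} _         F = identityˡ (F 0)
  when-≡ᵇ∙when-<ᵇ {suc k} {suc n} (s≤s k≤n) F = when-≡ᵇ∙when-<ᵇ k≤n (F ∘ suc)

∣m-n∣≡ᵇ1 : ∀ m n → (∣ m - n ∣ ≡ᵇ 1) ≡ ((suc n ≡ᵇ m) ∨ (n ≡ᵇ suc m))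
∣m-n∣≡ᵇ1 zero          zero          = ≡.refl
∣m-n∣≡ᵇ1 zero          (suc zero)    = ≡.refl
∣m-n∣≡ᵇ1 zero          (suc (suc n)) = ≡.refl
∣m-n∣≡ᵇ1 (suc zero)    zero          = ≡.refl
∣m-n∣≡ᵇ1 (suc (suc m)) zero          = ≡.refl
∣m-n∣≡ᵇ1 (suc m)       (suc n)       = ∣m-n∣≡ᵇ1 m n

suc≡ᵇ-≡ᵇsuc-exclusive : ∀ m n → ¬ (T (suc n ≡ᵇ m) × T (n ≡ᵇ suc m))
suc≡ᵇ-≡ᵇsuc-exclusive m n (n<m , m<n) =
  <-asym (≤-reflexive (≡ᵇ⇒≡ (suc n) m n<m)) (≤-reflexive (≡.sym (≡ᵇ⇒≡ n (suc m) m<n)))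

module _ {c ℓ : Level} (Γ : AbelianGroup c ℓ) where
  open AbelianGroup Γ
  open FiniteSums Γ

  weight-↑ : ∀ {m n} (H : Graph (m + n)) (L : Fin (m + n) → Carrier) x →
             weight Γ H L x ≈ ∑[ i < m ] when (adj H x (i ↑ˡ n)) (L (i ↑ˡ n))
                            ∙ ∑[ j < n ] when (adj H x (m ↑ʳ j)) (L (m ↑ʳ j))
  weight-↑ {m} H L x = trans (reflexive (sumWhere≡∑-when (adj H x) L)) (sum-↑ m _)

module Subdivided {c ℓ : Level} (Γ : AbelianGroup c ℓ) {m : ℕ} (G : Graph m)
                  (lab : Fin m → AbelianGroup.Carrier Γ) (u v : Fin m) (uv : adj G u v ≡ true)
                  (n′ : ℕ) (P : ℕ → AbelianGroup.Carrier Γ) where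
  -- P t is meant as the label of the t-th vertex of the path u, u₁, …, uₙ, v; the
  -- labelling extend only uses P 1, …, P n, while P 0 and P (n + 1) stand for lab u
  -- and lab v.
  open AbelianGroup Γ
  open FiniteSums Γ
  open import Algebra.Properties.CommutativeSemigroup commutativeSemigroup using (interchange)
  open import Relation.Binary.Reasoning.Setoid setoid

  private
    n : ℕ
    n = suc n′

  open Subdivision G u v n

  G† : Graph (m + n)
  G† = subdivide G u v n

  extend : Fin (m + n) → Carrier
  extend x = [ lab , (λ j → P (suc (toℕ j))) ]′ (splitAt m x)

  extend-↑ˡ : ∀ y → extend (y ↑ˡ n) ≡ lab y
  extend-↑ˡ y rewrite splitAt-↑ˡ m y n = ≡.refl

  extend-↑ʳ : ∀ j → extend (m ↑ʳ j) ≡ P (suc (toℕ j))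
  extend-↑ʳ j rewrite splitAt-↑ʳ m n j = ≡.refl

  adj†-↑ˡ-↑ˡ : ∀ x y → adj G† (x ↑ˡ n) (y ↑ˡ n) ≡ adj G x y ∧ not (isUV x y)
  adj†-↑ˡ-↑ˡ x y rewrite splitAt-↑ˡ m x n | splitAt-↑ˡ m y n = ≡.refl

  adj†-↑ˡ-↑ʳ : ∀ x j → adj G† (x ↑ˡ n) (m ↑ʳ j) ≡ endAdj x j
  adj†-↑ˡ-↑ʳ x j rewrite splitAt-↑ˡ m x n | splitAt-↑ʳ m n j = ≡.refl

  adj†-↑ʳ-↑ˡ : ∀ j y → adj G† (m ↑ʳ j) (y ↑ˡ n) ≡ endAdj y j
  adj†-↑ʳ-↑ˡ j y rewrite splitAt-↑ʳ m n j | splitAt-↑ˡ m y n = ≡.refl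

  adj†-↑ʳ-↑ʳ : ∀ i j → adj G† (m ↑ʳ i) (m ↑ʳ j) ≡ (∣ toℕ i - toℕ j ∣ ≡ᵇ 1)
  adj†-↑ʳ-↑ʳ i j rewrite splitAt-↑ʳ m n i | splitAt-↑ʳ m n j = ≡.refl

  u≢v : u ≢ v
  u≢v ≡.refl with ≡.trans (≡.sym uv) (irrefl G u)
  ... | ()

  ==-exclusive : ∀ a b c → ¬ (T (a == u ∧ b) × T (a == v ∧ c))
  ==-exclusive a b c (a≡u∧b , a≡v∧c) =
    u≢v (≡.trans (≡.sym (toWitness (proj₁ (Equivalence.to (T-∧ {a == u}) a≡u∧b))))
                 (toWitness (proj₁ (Equivalence.to (T-∧ {a == v}) a≡v∧c))))

  isUV⇒adj : ∀ x y → T (isUV x y) → T (adj G x y)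
  isUV⇒adj x y xy≡uv with Equivalence.to (T-∨ {x == u ∧ y == v}) xy≡uv
  ... | inj₁ x≡u∧y≡v with Equivalence.to (T-∧ {x == u}) x≡u∧y≡v
  ...   | x≡u , y≡v rewrite toWitness x≡u | toWitness y≡v = Equivalence.from T-≡ uv
  isUV⇒adj x y xy≡uv | inj₂ x≡v∧y≡u with Equivalence.to (T-∧ {x == v}) x≡v∧y≡u
  ...   | x≡v , y≡u rewrite toWitness x≡v | toWitness y≡u =
    Equivalence.from T-≡ (≡.trans (Graph.sym G v u) uv)

  uv-term : Fin m → Carrier
  uv-term x = when (x == u) (lab v) ∙ when (x == v) (lab u)

  ∑-removed-edge : ∀ x → ∑[ y < m ] when (isUV x y) (lab y) ≈ uv-term x
  ∑-removed-edge x = trans (sum-when-∨ _ _ lab (λ y → ==-exclusive x (y == v) (y == u)))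
                           (∙-cong (sum-when-∧-≟ (x == u) v lab) (sum-when-∧-≟ (x == v) u lab))

  ∑-path-ends : P 1 ≈ lab v → P n ≈ lab u →
                ∀ x → ∑[ j < n ] when (endAdj x j) (P (suc (toℕ j))) ≈ uv-term x
  ∑-path-ends P₁≈lab-v Pₙ≈lab-u x = begin
    ∑[ j < n ] when (endAdj x j) (P (suc (toℕ j)))
      ≈⟨ sum-when-∨ {n} _ _ (P ∘ suc ∘ toℕ) (λ j → ==-exclusive x (toℕ j ≡ᵇ 0) (toℕ j ≡ᵇ n′)) ⟩
    ∑[ j < n ] when (x == u ∧ (toℕ j ≡ᵇ 0)) (P (suc (toℕ j)))
      ∙ ∑[ j < n ] when (x == v ∧ (toℕ j ≡ᵇ n′)) (P (suc (toℕ j)))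
      ≈⟨ ∙-cong (sum-when-∧-toℕ≡ᵇ {n} (x == u) 0 (P ∘ suc))
                (sum-when-∧-toℕ≡ᵇ {n} (x == v) n′ (P ∘ suc)) ⟩
    when (x == u) (P 1) ∙ when (x == v) (when (n′ <ᵇ n) (P n))
      ≈⟨ ∙-cong (when-cong (x == u) P₁≈lab-v)
                (when-cong (x == v) (trans (reflexive (when-<ᵇ (P n) (n<1+n n′))) Pₙ≈lab-u)) ⟩
    uv-term x ∎

  weight†-↑ˡ : P 1 ≈ lab v → P n ≈ lab u → ∀ x → weight Γ G† extend (x ↑ˡ n) ≈ weight Γ G lab x
  weight†-↑ˡ P₁≈lab-v Pₙ≈lab-u x = begin
    weight Γ G† extend (x ↑ˡ n)
      ≈⟨ weight-↑ Γ {m} G† extend (x ↑ˡ n) ⟩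
    ∑[ y < m ] when (adj G† (x ↑ˡ n) (y ↑ˡ n)) (extend (y ↑ˡ n))
      ∙ ∑[ j < n ] when (adj G† (x ↑ˡ n) (m ↑ʳ j)) (extend (m ↑ʳ j))
      ≡⟨ ≡.cong₂ _∙_ (sum-cong-≗ (λ y → ≡.cong₂ when (adj†-↑ˡ-↑ˡ x y) (extend-↑ˡ y)))
                      (sum-cong-≗ {n} (λ j → ≡.cong₂ when (adj†-↑ˡ-↑ʳ x j) (extend-↑ʳ j))) ⟩
    ∑[ y < m ] when (adj G x y ∧ not (isUV x y)) (lab y) ∙ ∑[ j < n ] when (endAdj x j) (P (suc (toℕ j)))
      ≈⟨ ∙-congˡ (trans (∑-path-ends P₁≈lab-v Pₙ≈lab-u x) (sym (∑-removed-edge x))) ⟩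
    ∑[ y < m ] when (adj G x y ∧ not (isUV x y)) (lab y) ∙ ∑[ y < m ] when (isUV x y) (lab y)
      ≈⟨ sym (∑-distrib-+ {m} _ _) ⟩
    ∑[ y < m ] (when (adj G x y ∧ not (isUV x y)) (lab y) ∙ when (isUV x y) (lab y))
      ≈⟨ sum-cong-≋ (λ y → sym (when-∧-not (adj G x y) (isUV x y) (lab y) (isUV⇒adj x y))) ⟩
    ∑[ y < m ] when (adj G x y) (lab y)
      ≡⟨ ≡.sym (sumWhere≡∑-when (adj G x) lab) ⟩
    weight Γ G lab x ∎

  ∑-attached-ends : ∀ j → ∑[ y < m ] when (endAdj y j) (lab y)
                          ≈ when (toℕ j ≡ᵇ 0) (lab u) ∙ when (toℕ j ≡ᵇ n′) (lab v)
  ∑-attached-ends j =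
    trans (sum-when-∨ _ _ lab (λ y → ==-exclusive y (toℕ j ≡ᵇ 0) (toℕ j ≡ᵇ n′)))
          (∙-cong (sum-when-≟-∧ u (toℕ j ≡ᵇ 0) lab) (sum-when-≟-∧ v (toℕ j ≡ᵇ n′) lab))

  ∑-path-neighbours : ∀ t → ∑[ i < n ] when (∣ t - toℕ i ∣ ≡ᵇ 1) (P (suc (toℕ i)))
                            ≈ ∑[ i < n ] when (suc (toℕ i) ≡ᵇ t) (P (suc (toℕ i)))
                              ∙ when (t <ᵇ n′) (P (2 + t))
  ∑-path-neighbours t = begin
    ∑[ i < n ] when (∣ t - toℕ i ∣ ≡ᵇ 1) (P (suc (toℕ i)))
      ≡⟨ sum-cong-≗ {n} (λ i → ≡.cong (λ b → when b (P (suc (toℕ i)))) (∣m-n∣≡ᵇ1 t (toℕ i))) ⟩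
    ∑[ i < n ] when ((suc (toℕ i) ≡ᵇ t) ∨ (toℕ i ≡ᵇ suc t)) (P (suc (toℕ i)))
      ≈⟨ sum-when-∨ {n} _ _ (P ∘ suc ∘ toℕ) (λ i → suc≡ᵇ-≡ᵇsuc-exclusive t (toℕ i)) ⟩
    ∑[ i < n ] when (suc (toℕ i) ≡ᵇ t) (P (suc (toℕ i)))
      ∙ ∑[ i < n ] when (toℕ i ≡ᵇ suc t) (P (suc (toℕ i)))
      ≈⟨ ∙-congˡ (sum-when-toℕ≡ᵇ {n} (suc t) (P ∘ suc)) ⟩
    ∑[ i < n ] when (suc (toℕ i) ≡ᵇ t) (P (suc (toℕ i))) ∙ when (t <ᵇ n′) (P (2 + t)) ∎

  weight†-↑ʳ : P 0 ≈ lab u → P (suc n) ≈ lab v →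
               ∀ j → weight Γ G† extend (m ↑ʳ j) ≈ P (toℕ j) ∙ P (2 + toℕ j)
  weight†-↑ʳ P₀≈lab-u Pₙ₊₁≈lab-v j = begin
    weight Γ G† extend (m ↑ʳ j)
      ≈⟨ weight-↑ Γ {m} G† extend (m ↑ʳ j) ⟩
    ∑[ y < m ] when (adj G† (m ↑ʳ j) (y ↑ˡ n)) (extend (y ↑ˡ n))
      ∙ ∑[ i < n ] when (adj G† (m ↑ʳ j) (m ↑ʳ i)) (extend (m ↑ʳ i))
      ≡⟨ ≡.cong₂ _∙_ (sum-cong-≗ (λ y → ≡.cong₂ when (adj†-↑ʳ-↑ˡ j y) (extend-↑ˡ y)))
                      (sum-cong-≗ {n} (λ i → ≡.cong₂ when (adj†-↑ʳ-↑ʳ j i) (extend-↑ʳ i))) ⟩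
    ∑[ y < m ] when (endAdj y j) (lab y) ∙ ∑[ i < n ] when (∣ t - toℕ i ∣ ≡ᵇ 1) (P (suc (toℕ i)))
      ≈⟨ ∙-cong (∑-attached-ends j) (∑-path-neighbours t) ⟩
    (when (t ≡ᵇ 0) (lab u) ∙ when (t ≡ᵇ n′) (lab v))
      ∙ (∑[ i < n ] when (suc (toℕ i) ≡ᵇ t) (P (suc (toℕ i))) ∙ when (t <ᵇ n′) (P (2 + t)))
      ≈⟨ interchange _ _ _ _ ⟩
    (when (t ≡ᵇ 0) (lab u) ∙ ∑[ i < n ] when (suc (toℕ i) ≡ᵇ t) (P (suc (toℕ i))))
      ∙ (when (t ≡ᵇ n′) (lab v) ∙ when (t <ᵇ n′) (P (2 + t)))
      ≈⟨ ∙-cong from-u-side from-v-side ⟩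
    P t ∙ P (2 + t) ∎
    where
    t = toℕ j
    from-u-side : when (t ≡ᵇ 0) (lab u) ∙ ∑[ i < n ] when (suc (toℕ i) ≡ᵇ t) (P (suc (toℕ i))) ≈ P t
    from-u-side = trans (∙-congʳ (when-cong (t ≡ᵇ 0) (sym P₀≈lab-u)))
                        (when-≡ᵇ0∙sum-when-suc≡ᵇ {n} t (<⇒≤ (toℕ<n j)) P)
    from-v-side : when (t ≡ᵇ n′) (lab v) ∙ when (t <ᵇ n′) (P (2 + t)) ≈ P (2 + t)
    from-v-side = trans (∙-congʳ (when-cong (t ≡ᵇ n′) (sym Pₙ₊₁≈lab-v)))
                        (when-≡ᵇ∙when-<ᵇ (≤-pred (toℕ<n j)) (P ∘ suc ∘ suc))

  extend-nonzero : (∀ x → ¬ lab x ≈ ε) → (∀ t → ¬ P t ≈ ε) → ∀ x → ¬ extend x ≈ ε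
  extend-nonzero lab≉ε P≉ε x with splitAt m x
  ... | inj₁ y = lab≉ε y
  ... | inj₂ j = P≉ε (suc (toℕ j))

↑-elim : ∀ {m n p} (Q : Fin (m + n) → Set p) →
         (∀ i → Q (i ↑ˡ n)) → (∀ j → Q (m ↑ʳ j)) → ∀ x → Q x
↑-elim {m} {n} Q old new x =
  ≡.subst Q (join-splitAt m n x) ([_,_] {C = Q ∘ Fin.join m n} old new (splitAt m x))

aabb : ∀ {a} {A : Set a} → A → A → ℕ → A
aabb x y 0 = x
aabb x y 1 = x
aabb x y 2 = y
aabb x y 3 = y
aabb x y (suc (suc (suc (suc t)))) = aabb x y t

aabb-all : ∀ {a p} {A : Set a} (Q : A → Set p) {x y} → Q x → Q y → ∀ t → Q (aabb x y t)
aabb-all Q Qx Qy 0 = Qx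
aabb-all Q Qx Qy 1 = Qx
aabb-all Q Qx Qy 2 = Qy
aabb-all Q Qx Qy 3 = Qy
aabb-all Q Qx Qy (suc (suc (suc (suc t)))) = aabb-all Q Qx Qy t

aabb-periodic : ∀ {a} {A : Set a} (x y : A) {k} → 4 ∣ k → ∀ t → aabb x y (t + k) ≡ aabb x y t
aabb-periodic x y (divides q ≡.refl) t = ≡.trans (≡.cong (aabb x y) (+-comm t (q * 4))) (shift q)
  where
  shift : ∀ q → aabb x y (q * 4 + t) ≡ aabb x y t
  shift zero    = ≡.refl
  shift (suc q) = shift q

module _ {c ℓ : Level} (Γ : AbelianGroup c ℓ) where
  open AbelianGroup Γ

  aabb-∙-aabb-2+ : ∀ x y t → aabb x y t ∙ aabb x y (2 + t) ≈ x ∙ y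
  aabb-∙-aabb-2+ x y 0 = refl
  aabb-∙-aabb-2+ x y 1 = refl
  aabb-∙-aabb-2+ x y 2 = comm y x
  aabb-∙-aabb-2+ x y 3 = comm y x
  aabb-∙-aabb-2+ x y (suc (suc (suc (suc t)))) = aabb-∙-aabb-2+ x y t

theorem2p14 : {c ℓ : Level} (Γ : AbelianGroup c ℓ) → IsFiniteGroup Γ →
    {m : ℕ} (G : Graph m) → AllNeutral G →
    (lab : Fin m → AbelianGroup.Carrier Γ) (g : AbelianGroup.Carrier Γ) →
    IsVertexMagicLabeling Γ G lab g →
    (u v : Fin m) → adj G u v ≡ true →
    AbelianGroup._≈_ Γ (lab u) (lab v) → ¬ AbelianGroup._≈_ Γ (lab u) g →
    (n : ℕ) → 0 < n → 4 ∣ n →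
    IsVertexMagic Γ (subdivide G u v n)
theorem2p14 Γ _ {m} G _ lab g (lab≉ε , weight≈g) u v uv lab-u≈lab-v lab-u≉g (suc n′) _ 4∣n =
  extend , g , extend-nonzero lab≉ε (aabb-all (λ x → ¬ x ≈ ε) (lab≉ε u) b≉ε) ,
  ↑-elim (λ x → weight Γ G† extend x ≈ g) old-vertex new-vertex
  where
  open AbelianGroup Γ
  open import Algebra.Properties.Group group using (\\-leftDividesˡ; x∙y⁻¹≈ε⇒x≈y)
  a b : Carrier
  a = lab u
  b = a ⁻¹ ∙ g
  open Subdivided Γ G lab u v uv n′ (aabb a b)

  b≉ε : ¬ b ≈ ε
  b≉ε b≈ε = lab-u≉g (sym (x∙y⁻¹≈ε⇒x≈y g a (trans (comm g (a ⁻¹)) b≈ε)))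

  old-vertex : ∀ y → weight Γ G† extend (y ↑ˡ suc n′) ≈ g
  old-vertex y = trans (weight†-↑ˡ lab-u≈lab-v (reflexive (aabb-periodic a b 4∣n 0)) y) (weight≈g y)

  new-vertex : ∀ j → weight Γ G† extend (m ↑ʳ j) ≈ g
  new-vertex j = begin
    weight Γ G† extend (m ↑ʳ j)
      ≈⟨ weight†-↑ʳ refl (trans (reflexive (aabb-periodic a b 4∣n 1)) lab-u≈lab-v) j ⟩
    aabb a b t ∙ aabb a b (2 + t) ≈⟨ aabb-∙-aabb-2+ Γ a b t ⟩
    a ∙ b                         ≈⟨ \\-leftDividesˡ a g ⟩
    g                             ∎
    where
    t = toℕ j
    open import Relation.Binary.Reasoning.Setoid setoid
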